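{- Let $\mathbf D\subseteq\mathbf T$ be a Condorcet super-domain, let $V$ be a finite set of odd cardinality, let $(T_v)_{v\in V}$ be a family of tilings with all $T_v\in\mathbf D$, and let $T=sm((T_v)_{v\in V})$. Then $\mathbf D\cup\{T\}$ is a Condorcet super-domain as well.
   Context: Fix an integer $n\ge 2$, $[n]=\{1,\dots,n\}$, and let $\Lambda$ be the set of triples $ijk$ with $i<j<k$ in $[n]$. For a quadruple $i<j<k<l$, its stick is the ordered sequence $(ijk,ijl,ikl,jkl)$. A subset of $\Lambda$ is a pseudo-tiling; it is a tiling if for every quadruple $i<j<k<l$ its intersection with the stick, written as a 0/1 string along the stick order, is one of $0000,1000,1100,1110,1111,0111,0011,0001$ (these are the inversion sets of rhombus tilings of the zonogon $Z(n;2)$). $\mathbf T$ denotes the set of tilings; a super-domain is a subset of $\mathbf T$. Majority rule: for a finite set $V$ of odd cardinality and a family $(T_v)_{v\in V}$ of tilings (repetitions allowed), $sm((T_v)_{v\in V})=\{ijk\in\Lambda: |\{v: ijk\in T_v\}|>|V|/2\}$. A super-domain $\mathbf D$ is a Condorcet super-domain if for every finite odd-cardinality $V$ and every family $(T_v)_{v\in V}$ with all $T_v\in\mathbf D$, $sm((T_v)_{v\in V})$ is a tiling. -}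

module Defs where

open import Data.Nat using (ℕ; zero; suc; _+_; _*_; _<_; _≤_)
open import Data.Fin using (Fin) renaming (_<_ to _<ᶠ_; zero to fzero; suc to fsuc)
open import Data.Bool using (Bool; true; false)
open import Data.Product using (Σ; _×_)
open import Data.Sum using (_⊎_)
open import Relation.Binary.PropositionalEquality using (_≡_)
import Relation.Nullary
import Data.Nat

-- A pseudo-tiling: a subset of Λ = {ijk : i<j<k} of [n], given by its
-- characteristic function on triples of elements of Fin n.  Only the values
-- at i<j<k are meaningful (IsTiling only inspects those).
PseudoTiling : ℕ → Set
PseudoTiling n = Fin n → Fin n → Fin n → Bool

data Admissible : Bool → Bool → Bool → Bool → Set where
  a0000 : Admissible false false false false
  a1000 : Admissible true  false false false
  a1100 : Admissible true  true  false false
  a1110 : Admissible true  true  true  false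
  a1111 : Admissible true  true  true  true
  a0111 : Admissible false true  true  true
  a0011 : Admissible false false true  true
  a0001 : Admissible false false false true

IsTiling : {n : ℕ} → PseudoTiling n → Set
IsTiling {n} T = (i j k l : Fin n) → i <ᶠ j → j <ᶠ k → k <ᶠ l →
  Admissible (T i j k) (T i j l) (T i k l) (T j k l)

SuperDomain : ℕ → Set₁
SuperDomain n = PseudoTiling n → Set

countTrue : {m : ℕ} → (Fin m → Bool) → ℕ
countTrue {zero}  f = 0
countTrue {suc m} f with f fzero
... | true  = suc (countTrue (λ v → f (fsuc v)))
... | false = countTrue (λ v → f (fsuc v))

_>half_ : ℕ → ℕ → Bool
c >half m with suc m Data.Nat.≤? (c + c)
... | Relation.Nullary.yes _ = true
... | Relation.Nullary.no  _ = false

sm : {n m : ℕ} → (Fin m → PseudoTiling n) → PseudoTiling n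
sm {n} {m} F i j k = countTrue (λ v → F v i j k) >half m

Odd : ℕ → Set
Odd m = Σ ℕ (λ t → m ≡ suc (t + t))

-- Condorcet super-domain: D ⊆ T, and every majority of an odd family from D
-- is a tiling.  (Finite voter sets V of cardinality m are represented by Fin m.)
IsCondorcet : {n : ℕ} → SuperDomain n → Set
IsCondorcet {n} D =
  ((S : PseudoTiling n) → D S → IsTiling S) ×
  ((m : ℕ) → Odd m → (F : Fin m → PseudoTiling n) →
     ((v : Fin m) → D (F v)) → IsTiling (sm F))

_∪｛_｝ : {n : ℕ} → SuperDomain n → PseudoTiling n → SuperDomain n
(D ∪｛ T ｝) S = D S ⊎ S ≡ T

-- Call D median-closed if the pointwise median of any three members of D is
-- a tiling.  Median-closedness suffices for D to be Condorcet: a stick of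
-- sm G that is not admissible carries a pattern e, ¬e, e on three of its
-- triples; two strict majorities of an odd electorate always share a voter,
-- so there are voters x, y, z agreeing with sm G on the first two, the last
-- two and the outer two of these triples, and then the median of G x, G y,
-- G z is a tiling carrying the same forbidden pattern.
-- A Condorcet domain D is median-closed, and so is D ∪ {sm F}: for A, B ∈ D
-- the median of A, B and sm F is the majority vote of m copies of A, m
-- copies of B and the m voters of F, and a median in which sm F occurs twice
-- is sm F itself.
module Submission where

open import Defs
open import Data.Nat using (ℕ; _≤_)
open import Data.Fin using (Fin)

open import Data.Bool using (Bool; true; false; not; if_then_else_)
open import Data.Fin using (splitAt) renaming (zero to fzero; suc to fsuc)
open import Data.Nat using (zero; suc; _+_; _<_; z≤n; s≤s; _≤?_)
open import Data.Nat.Properties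
open import Data.Nat.Solver using (module +-*-Solver)
open import Data.Product using (Σ; ∃; _×_; _,_; proj₁; proj₂) renaming (map to Σ-map)
open import Data.Sum using (inj₁; inj₂)
open import Data.Sum.Properties using ([,]-map)
open import Data.Vec.Functional using (_++_; replicate)
open import Data.Vec.Functional.Relation.Unary.All using (All)
open import Data.Vec.Functional.Relation.Unary.All.Properties using (++⁺)
open import Function using (_∘_; id; _⇔_; mk⇔; Equivalence)
open import Relation.Binary.PropositionalEquality
open import Relation.Nullary using (¬_; yes; no)
open import Relation.Nullary.Reflects using (Reflects; ofʸ; ofⁿ; det)
open +-*-Solver

countTrue-cong : ∀ {m} {f g : Fin m → Bool} → (∀ v → f v ≡ g v) → countTrue f ≡ countTrue g
countTrue-cong {zero} _ = refl
countTrue-cong {suc m} {f} {g} f≗g with f fzero | g fzero | f≗g fzero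
... | true  | true  | _ = cong suc (countTrue-cong (f≗g ∘ fsuc))
... | false | false | _ = countTrue-cong (f≗g ∘ fsuc)
... | true  | false | ()
... | false | true  | ()

countTrue-++ : ∀ {a b} {A : Set} (P : A → Bool) (xs : Fin a → A) (ys : Fin b → A) →
  countTrue (P ∘ (xs ++ ys)) ≡ countTrue (P ∘ xs) + countTrue (P ∘ ys)
countTrue-++ {zero} P xs ys = refl
countTrue-++ {suc a} P xs ys with P (xs fzero)
... | true  = cong suc (trans (countTrue-cong (cong P ∘ [,]-map ∘ splitAt a))
                              (countTrue-++ P (xs ∘ fsuc) ys))
... | false = trans (countTrue-cong (cong P ∘ [,]-map ∘ splitAt a))
                    (countTrue-++ P (xs ∘ fsuc) ys)

countTrue-replicate : ∀ m b → countTrue (replicate m b) ≡ (if b then m else 0)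
countTrue-replicate zero    true  = refl
countTrue-replicate zero    false = refl
countTrue-replicate (suc m) true  = cong suc (countTrue-replicate m true)
countTrue-replicate (suc m) false = countTrue-replicate m false

countTrue-≤ : ∀ {m} (f : Fin m → Bool) → countTrue f ≤ m
countTrue-≤ {zero} f = z≤n
countTrue-≤ {suc m} f with f fzero
... | true  = s≤s (countTrue-≤ (f ∘ fsuc))
... | false = m≤n⇒m≤1+n (countTrue-≤ (f ∘ fsuc))

countTrue-complement : ∀ {m} (f : Fin m → Bool) → countTrue f + countTrue (not ∘ f) ≡ m
countTrue-complement {zero} f = refl
countTrue-complement {suc m} f with f fzero
... | true  = cong suc (countTrue-complement (f ∘ fsuc))
... | false = trans (+-suc _ _) (cong suc (countTrue-complement (f ∘ fsuc)))

countTrue-pigeonhole : ∀ {m} (g h : Fin m → Bool) → m < countTrue g + countTrue h →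
  ∃ λ v → g v ≡ true × h v ≡ true
countTrue-pigeonhole {suc m} g h lt with g fzero in g₀ | h fzero in h₀
... | true  | true  = fzero , g₀ , h₀
... | true  | false = Σ-map fsuc id (countTrue-pigeonhole (g ∘ fsuc) (h ∘ fsuc) (≤-pred lt))
... | false | true  = Σ-map fsuc id (countTrue-pigeonhole (g ∘ fsuc) (h ∘ fsuc)
                                   (≤-pred (subst (suc m <_) (+-suc _ _) lt)))
... | false | false = Σ-map fsuc id (countTrue-pigeonhole (g ∘ fsuc) (h ∘ fsuc) (≤-trans (n≤1+n _) lt))

>half-reflects : ∀ c m → Reflects (m < c + c) (c >half m)
>half-reflects c m with suc m ≤? c + c
... | yes p  = ofʸ p
... | no ¬p  = ofⁿ ¬p

>half-true : ∀ {c m} → m < c + c → c >half m ≡ true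
>half-true p = det (>half-reflects _ _) (ofʸ p)

>half-false : ∀ {c m} → ¬ m < c + c → c >half m ≡ false
>half-false ¬p = det (>half-reflects _ _) (ofⁿ ¬p)

>half-cong : ∀ {c m c′ m′} → (m < c + c ⇔ m′ < c′ + c′) → c >half m ≡ c′ >half m′
>half-cong {c′ = c′} {m′} p⇔q with c′ >half m′ | >half-reflects c′ m′
... | true  | ofʸ q  = >half-true (Equivalence.from p⇔q q)
... | false | ofⁿ ¬q = >half-false (¬q ∘ Equivalence.to p⇔q)

majority : ∀ {m} → (Fin m → Bool) → Bool
majority {m} g = countTrue g >half m

agrees : Bool → Bool → Bool
agrees true  x = x
agrees false x = not x

agrees-sound : ∀ b x → agrees b x ≡ true → x ≡ b
agrees-sound true  true  _ = refl
agrees-sound false false _ = refl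

double≢odd : ∀ c t → c + c ≢ suc (t + t)
double≢odd zero    t       ()
double≢odd (suc c) zero    eq = 1+n≢0 (trans (sym (+-suc c c)) (suc-injective eq))
double≢odd (suc c) (suc t) eq =
  double≢odd c t (suc-injective
    (trans (sym (+-suc c c)) (trans (suc-injective eq) (cong suc (+-suc t t)))))

odd-strictMajority : ∀ {m c c′} → Odd m → c + c′ ≡ m → ¬ m < c + c → m < c′ + c′
odd-strictMajority {m} {c} {c′} (t , m≡) c+c′≡m m≮2c = +-cancelˡ-< m m (c′ + c′) (begin-strict
  m + m                   ≡⟨ cong₂ _+_ (sym c+c′≡m) (sym c+c′≡m) ⟩
  (c + c′) + (c + c′)     ≡⟨ solve 2 (λ c c′ → (c :+ c′) :+ (c :+ c′) := (c :+ c) :+ (c′ :+ c′))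
                                     refl c c′ ⟩
  (c + c) + (c′ + c′)     <⟨ +-monoˡ-< (c′ + c′) 2c<m ⟩
  m + (c′ + c′)           ∎)
  where
  open ≤-Reasoning
  2c<m : c + c < m
  2c<m = ≤∧≢⇒< (≮⇒≥ m≮2c) (λ 2c≡m → double≢odd c t (trans 2c≡m m≡))

majority-support : ∀ {m} → Odd m → (g : Fin m → Bool) →
  let k = countTrue (agrees (majority g) ∘ g) in m < k + k
majority-support {m} odd g with majority g | >half-reflects (countTrue g) m
... | true  | ofʸ p  = p
... | false | ofⁿ ¬p = odd-strictMajority {c = countTrue g} odd (countTrue-complement g) ¬p

<-double-sum : ∀ {m} a b → m < a + a → m < b + b → m < a + b
<-double-sum a b p q with ≤-total a b
... | inj₁ a≤b = <-≤-trans p (+-monoʳ-≤ a a≤b)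
... | inj₂ b≤a = <-≤-trans q (+-monoˡ-≤ b b≤a)

majorities-share-voter : ∀ {m} → Odd m → (g h : Fin m → Bool) →
  ∃ λ v → g v ≡ majority g × h v ≡ majority h
majorities-share-voter {m} odd g h =
  let v , gv , hv = countTrue-pigeonhole g′ h′
        (<-double-sum (countTrue g′) (countTrue h′) (majority-support odd g) (majority-support odd h))
  in v , agrees-sound _ (g v) gv , agrees-sound _ (h v) hv
  where
  g′ h′ : Fin m → Bool
  g′ = agrees (majority g) ∘ g
  h′ = agrees (majority h) ∘ h

maj₃ : Bool → Bool → Bool → Bool
maj₃ true  true  _ = true
maj₃ false false _ = false
maj₃ true  false c = c
maj₃ false true  c = c

maj₃-≡₁₂ : ∀ {a b c x} → a ≡ x → b ≡ x → maj₃ a b c ≡ x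
maj₃-≡₁₂ {true}  refl refl = refl
maj₃-≡₁₂ {false} refl refl = refl

maj₃-≡₁₃ : ∀ {a b c x} → a ≡ x → c ≡ x → maj₃ a b c ≡ x
maj₃-≡₁₃ {true}  {true}  refl refl = refl
maj₃-≡₁₃ {true}  {false} refl refl = refl
maj₃-≡₁₃ {false} {true}  refl refl = refl
maj₃-≡₁₃ {false} {false} refl refl = refl

maj₃-≡₂₃ : ∀ {a b c x} → b ≡ x → c ≡ x → maj₃ a b c ≡ x
maj₃-≡₂₃ {true}  {true}  refl refl = refl
maj₃-≡₂₃ {true}  {false} refl refl = refl
maj₃-≡₂₃ {false} {true}  refl refl = refl
maj₃-≡₂₃ {false} {false} refl refl = refl

maj₃-swap₂₃ : ∀ a b c → maj₃ a b c ≡ maj₃ a c b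
maj₃-swap₂₃ true  true  true  = refl
maj₃-swap₂₃ true  true  false = refl
maj₃-swap₂₃ true  false true  = refl
maj₃-swap₂₃ true  false false = refl
maj₃-swap₂₃ false true  true  = refl
maj₃-swap₂₃ false true  false = refl
maj₃-swap₂₃ false false true  = refl
maj₃-swap₂₃ false false false = refl

maj₃-rotate : ∀ a b c → maj₃ a b c ≡ maj₃ b c a
maj₃-rotate true  true  true  = refl
maj₃-rotate true  true  false = refl
maj₃-rotate true  false true  = refl
maj₃-rotate true  false false = refl
maj₃-rotate false true  true  = refl
maj₃-rotate false true  false = refl
maj₃-rotate false false true  = refl
maj₃-rotate false false false = refl

median : ∀ {n} → PseudoTiling n → PseudoTiling n → PseudoTiling n → PseudoTiling n
median A B C i j k = maj₃ (A i j k) (B i j k) (C i j k)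

IsTiling-cong : ∀ {n} {S S′ : PseudoTiling n} →
  (∀ i j k → S i j k ≡ S′ i j k) → IsTiling S → IsTiling S′
IsTiling-cong S≗S′ tS i j k l i<j j<k k<l
  rewrite sym (S≗S′ i j k) | sym (S≗S′ i j l) | sym (S≗S′ i k l) | sym (S≗S′ j k l)
  = tS i j k l i<j j<k k<l

-- A 0/1 string is admissible iff it changes value at most once, a condition
-- already visible on the three substrings containing the first position.
admissible-from-substrings : ∀ {a b c d} →
  ∃ (Admissible a b c) → ∃ (λ x → Admissible a b x d) → ∃ (λ x → Admissible a x c d) →
  Admissible a b c d
admissible-from-substrings {false} {false} {false} {false} _ _ _ = a0000
admissible-from-substrings {false} {false} {false} {true}  _ _ _ = a0001
admissible-from-substrings {false} {false} {true}  {false} _ _ (_ , ())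
admissible-from-substrings {false} {false} {true}  {true}  _ _ _ = a0011
admissible-from-substrings {false} {true}  {false} {_}     (_ , ()) _ _
admissible-from-substrings {false} {true}  {true}  {false} _ (_ , ()) _
admissible-from-substrings {false} {true}  {true}  {true}  _ _ _ = a0111
admissible-from-substrings {true}  {false} {false} {false} _ _ _ = a1000
admissible-from-substrings {true}  {false} {false} {true}  _ (_ , ()) _
admissible-from-substrings {true}  {false} {true}  {_}     (_ , ()) _ _
admissible-from-substrings {true}  {true}  {false} {false} _ _ _ = a1100
admissible-from-substrings {true}  {true}  {false} {true}  _ _ (_ , ())
admissible-from-substrings {true}  {true}  {true}  {false} _ _ _ = a1110
admissible-from-substrings {true}  {true}  {true}  {true}  _ _ _ = a1111

Admissible-subst : ∀ {a b c d a′ b′ c′ d′} →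
  a ≡ a′ → b ≡ b′ → c ≡ c′ → d ≡ d′ → Admissible a b c d → Admissible a′ b′ c′ d′
Admissible-subst refl refl refl refl adm = adm

MedianClosed : ∀ {n} → SuperDomain n → Set
MedianClosed D = ∀ A B C → D A → D B → D C → IsTiling (median A B C)

Triple : ℕ → Set
Triple n = Fin n × Fin n × Fin n

_at_ : ∀ {n} → PseudoTiling n → Triple n → Bool
S at τ = S (proj₁ τ) (proj₁ (proj₂ τ)) (proj₂ (proj₂ τ))

module _ {n : ℕ} {D : SuperDomain n} (closed : MedianClosed D) where

  median-realises-majority : ∀ {m} → Odd m → (G : Fin m → PseudoTiling n) → All D G →
    (τ₁ τ₂ τ₃ : Triple n) → Σ (PseudoTiling n) λ S → IsTiling S ×
      S at τ₁ ≡ sm G at τ₁ × S at τ₂ ≡ sm G at τ₂ × S at τ₃ ≡ sm G at τ₃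
  median-realises-majority odd G DG τ₁ τ₂ τ₃
    with majorities-share-voter odd (λ v → G v at τ₁) (λ v → G v at τ₂)
       | majorities-share-voter odd (λ v → G v at τ₂) (λ v → G v at τ₃)
       | majorities-share-voter odd (λ v → G v at τ₃) (λ v → G v at τ₁)
  ... | x , x₁ , x₂ | y , y₂ , y₃ | z , z₃ , z₁ =
    median (G x) (G y) (G z) , closed (G x) (G y) (G z) (DG x) (DG y) (DG z) ,
    maj₃-≡₁₃ x₁ z₁ , maj₃-≡₁₂ x₂ y₂ , maj₃-≡₂₃ y₃ z₃

  medianClosed⇒sm-isTiling : (m : ℕ) → Odd m → (G : Fin m → PseudoTiling n) → All D G →
    IsTiling (sm G)
  medianClosed⇒sm-isTiling m odd G DG i j k l i<j j<k k<l
    with median-realises-majority odd G DG (i , j , k) (i , j , l) (i , k , l)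
       | median-realises-majority odd G DG (i , j , k) (i , j , l) (j , k , l)
       | median-realises-majority odd G DG (i , j , k) (i , k , l) (j , k , l)
  ... | S , tS , e₁ , e₂ , e₃ | S′ , tS′ , e₁′ , e₂′ , e₄′ | S″ , tS″ , e₁″ , e₃″ , e₄″ =
    admissible-from-substrings
      (_ , Admissible-subst e₁ e₂ e₃ refl (tS i j k l i<j j<k k<l))
      (_ , Admissible-subst e₁′ e₂′ refl e₄′ (tS′ i j k l i<j j<k k<l))
      (_ , Admissible-subst e₁″ refl e₃″ e₄″ (tS″ i j k l i<j j<k k<l))

odd-+-double : ∀ {m} k → Odd m → Odd (m + (k + k))
odd-+-double k (t , refl) =
  t + k , solve 2 (λ t k → (con 1 :+ (t :+ t)) :+ (k :+ k) := con 1 :+ ((t :+ k) :+ (t :+ k)))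
                  refl t k

odd⇒positive : ∀ {m} → Odd m → 0 < m
odd⇒positive (_ , refl) = s≤s z≤n

3m<2[m+f]⇔m<2f : ∀ m f → m + (m + m) < (m + f) + (m + f) ⇔ m < f + f
3m<2[m+f]⇔m<2f m f = mk⇔
  (+-cancelˡ-< (m + m) m (f + f) ∘ subst₂ _<_ 3m≡ 2[m+f]≡)
  (subst₂ _<_ (sym 3m≡) (sym 2[m+f]≡) ∘ +-monoʳ-< (m + m))
  where
  3m≡ : m + (m + m) ≡ (m + m) + m
  3m≡ = +-comm m (m + m)
  2[m+f]≡ : (m + f) + (m + f) ≡ (m + m) + (f + f)
  2[m+f]≡ = solve 2 (λ m f → (m :+ f) :+ (m :+ f) := (m :+ m) :+ (f :+ f)) refl m f

-- Three blocks of m voters: one voting a, one voting b, and one in which f vote yes.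
>half-blocks : ∀ {m f} a b → 0 < m → f ≤ m →
  ((if a then m else 0) + ((if b then m else 0) + f)) >half (m + (m + m)) ≡ maj₃ a b (f >half m)
>half-blocks {m} {f} true true 0<m f≤m = >half-true (begin-strict
  m + (m + m)                      <⟨ m<m+n (m + (m + m)) (<-≤-trans 0<m (m≤m+n m (f + f))) ⟩
  (m + (m + m)) + (m + (f + f))    ≡⟨ solve 2 (λ m f → (m :+ (m :+ m)) :+ (m :+ (f :+ f))
                                                   := (m :+ (m :+ f)) :+ (m :+ (m :+ f))) refl m f ⟩
  (m + (m + f)) + (m + (m + f))    ∎)
  where open ≤-Reasoning
>half-blocks {m} {f} false false 0<m f≤m =
  >half-false (≤⇒≯ (≤-trans (+-mono-≤ f≤m f≤m) (m≤n+m (m + m) m)))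
>half-blocks {m} {f} true  false 0<m f≤m = >half-cong (3m<2[m+f]⇔m<2f m f)
>half-blocks {m} {f} false true  0<m f≤m = >half-cong (3m<2[m+f]⇔m<2f m f)

countTrue-blocks : ∀ {m} {A : Set} (P : A → Bool) (a b : A) (xs : Fin m → A) →
  countTrue (P ∘ (replicate m a ++ (replicate m b ++ xs)))
    ≡ (if P a then m else 0) + ((if P b then m else 0) + countTrue (P ∘ xs))
countTrue-blocks {m} P a b xs = begin
  countTrue (P ∘ (replicate m a ++ (replicate m b ++ xs)))
    ≡⟨ countTrue-++ P (replicate m a) (replicate m b ++ xs) ⟩
  countTrue (replicate m (P a)) + countTrue (P ∘ (replicate m b ++ xs))
    ≡⟨ cong₂ _+_ (countTrue-replicate m (P a)) (countTrue-++ P (replicate m b) xs) ⟩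
  (if P a then m else 0) + (countTrue (replicate m (P b)) + countTrue (P ∘ xs))
    ≡⟨ cong (λ k → (if P a then m else 0) + (k + countTrue (P ∘ xs))) (countTrue-replicate m (P b)) ⟩
  (if P a then m else 0) + ((if P b then m else 0) + countTrue (P ∘ xs))  ∎
  where open ≡-Reasoning

module _ {n : ℕ} {D : SuperDomain n} (condorcet : IsCondorcet D) where

  median-sm-isTiling : ∀ A B → D A → D B → ∀ {m} → Odd m → (F : Fin m → PseudoTiling n) → All D F →
    IsTiling (median A B (sm F))
  median-sm-isTiling A B dA dB {m} odd F DF =
    IsTiling-cong sm-blocks (proj₂ condorcet (m + (m + m)) (odd-+-double m odd) H DH)
    where
    H : Fin (m + (m + m)) → PseudoTiling n
    H = replicate m A ++ (replicate m B ++ F)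
    DH : All D H
    DH = ++⁺ D {replicate m A} (λ _ → dA) (++⁺ D {replicate m B} (λ _ → dB) DF)
    sm-blocks : ∀ i j k → sm H i j k ≡ median A B (sm F) i j k
    sm-blocks i j k =
      trans (cong (_>half (m + (m + m))) (countTrue-blocks (λ S → S i j k) A B F))
            (>half-blocks (A i j k) (B i j k) (odd⇒positive odd) (countTrue-≤ (λ v → F v i j k)))

  medianClosed : MedianClosed D
  medianClosed A B C dA dB dC =
    IsTiling-cong (λ i j k → cong (maj₃ (A i j k) (B i j k)) (singleton (C i j k)))
      (median-sm-isTiling A B dA dB (0 , refl) (replicate 1 C) (λ _ → dC))
    where
    singleton : ∀ b → countTrue (replicate 1 b) >half 1 ≡ b
    singleton true  = refl
    singleton false = refl

  medianClosed-∪-sm : ∀ {m} → Odd m → (F : Fin m → PseudoTiling n) → All D F →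
    MedianClosed (D ∪｛ sm F ｝)
  medianClosed-∪-sm {m} odd F DF = closed
    where
    T : PseudoTiling n
    T = sm F
    tiling : IsTiling T
    tiling = proj₂ condorcet m odd F DF
    closed : MedianClosed (D ∪｛ T ｝)
    closed A B C (inj₁ dA) (inj₁ dB) (inj₁ dC) = medianClosed A B C dA dB dC
    closed A B _ (inj₁ dA) (inj₁ dB) (inj₂ refl) = median-sm-isTiling A B dA dB odd F DF
    closed A _ C (inj₁ dA) (inj₂ refl) (inj₁ dC) =
      IsTiling-cong (λ i j k → maj₃-swap₂₃ (A i j k) (C i j k) (T i j k))
        (median-sm-isTiling A C dA dC odd F DF)
    closed _ B C (inj₂ refl) (inj₁ dB) (inj₁ dC) =
      IsTiling-cong (λ i j k → sym (maj₃-rotate (T i j k) (B i j k) (C i j k)))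
        (median-sm-isTiling B C dB dC odd F DF)
    closed _ _ _ (inj₂ refl) (inj₂ refl) _ = IsTiling-cong (λ i j k → sym (maj₃-≡₁₂ refl refl)) tiling
    closed _ _ _ (inj₂ refl) _ (inj₂ refl) = IsTiling-cong (λ i j k → sym (maj₃-≡₁₃ refl refl)) tiling
    closed _ _ _ _ (inj₂ refl) (inj₂ refl) = IsTiling-cong (λ i j k → sym (maj₃-≡₂₃ refl refl)) tiling

mainTheorem4 : (n : ℕ) → 2 ≤ n → (D : SuperDomain n) → IsCondorcet D →
    (m : ℕ) → Odd m → (F : Fin m → PseudoTiling n) → ((v : Fin m) → D (F v)) →
    IsCondorcet (D ∪｛ sm F ｝)
mainTheorem4 n _ D condorcet m odd F DF =
  ⊆tilings , medianClosed⇒sm-isTiling {D = D ∪｛ sm F ｝} (medianClosed-∪-sm condorcet odd F DF)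
  where
  ⊆tilings : (S : PseudoTiling n) → (D ∪｛ sm F ｝) S → IsTiling S
  ⊆tilings S (inj₁ dS)   = proj₁ condorcet S dS
  ⊆tilings _ (inj₂ refl) = proj₂ condorcet m odd F DF
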